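{- The map $\omega\mapsto\mathcal T_\omega$ is a bijection from the set of all finite permutations of the positive integers (i.e. $\varinjlim_n S_n$) onto the set of all tower diagrams.
   Context: $s_i$ denotes the adjacent transposition $(i,i+1)$ of the positive integers; a finite permutation is a bijection of the positive integers fixing all but finitely many points. A reduced word of $\omega$ is a word $\alpha_1\cdots\alpha_\ell$ with $\omega=s_{\alpha_1}\cdots s_{\alpha_\ell}$ and $\ell$ minimal (the empty word for the identity). A cell is a pair $(i,j)$ of integers with $i\ge 1$, $j\ge 0$. A tower diagram is a finite (possibly empty) set $\mathcal T$ of cells such that $(i,j)\in\mathcal T$ and $0\le k\le j$ imply $(i,k)\in\mathcal T$. The cell $(i,j)$ lies on the diagonal $x+y=i+j$. Sliding: for a positive integer $\alpha$, $\alpha^{\searrow}\mathcal T$ is computed by the procedure $P(\gamma,m)$ started at $\gamma=\alpha$, $m=1$: (S1) if no cell $(i,j)\in\mathcal T$ with $i\ge m$ lies on $x+y=\gamma-1$: (a) if $(\gamma,0)\notin\mathcal T$ the result is $\mathcal T\cup\{(\gamma,0)\}$; (b) if $(\gamma,0)\in\mathcal T$, $(\gamma,1)\notin\mathcal T$ the slide terminates (without result); (c) if $(\gamma,0),(\gamma,1)\in\mathcal T$, continue with $P(\gamma+1,\gamma+1)$. (S2) Otherwise let $i\ge m$ be smallest with $(i,\gamma-1-i)\in\mathcal T$: (a) if $(i,\gamma-i)\notin\mathcal T$ the result is $\mathcal T\cup\{(i,\gamma-i)\}$; (b) if $(i,\gamma-i)\in\mathcal T$, $(i,\gamma-i+1)\notin\mathcal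 T$ the slide terminates; (c) if both are in $\mathcal T$, continue with $P(\gamma+1,i+1)$. For a word $\alpha_1\cdots\alpha_n$, its tower diagram (when defined) is obtained by starting from $\varnothing$ and successively sliding $\alpha_1,\alpha_2,\dots,\alpha_n$. For a reduced word no slide terminates, and $\mathcal T_\omega$ denotes the tower diagram of any reduced word of $\omega$ (independent of the choice). -}

module Defs where

open import Data.Nat using (ℕ; zero; suc; _≤_; _<_; _∸_; _≡ᵇ_)
open import Data.Bool using (Bool; true; false; if_then_else_; _∨_; _∧_)
open import Data.List using (List; []; _∷_; length)
open import Data.List.Relation.Unary.All using (All)
open import Data.Maybe using (Maybe; just; nothing)
open import Data.Product using (_×_; _,_; Σ; ∃)
open import Relation.Binary.PropositionalEquality using (_≡_)

-- Finite permutations of the positive integers.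
-- Convention: a permutation is a bijection of ℕ fixing 0, so that its
-- restriction to the positive integers is a bijection of {1,2,...}.

record FinPerm : Set where
  field
    fun      : ℕ → ℕ
    inv      : ℕ → ℕ
    fun-inv  : ∀ n → fun (inv n) ≡ n
    inv-fun  : ∀ n → inv (fun n) ≡ n
    fix-zero : fun 0 ≡ 0
    support  : Σ ℕ λ N → ∀ n → N ≤ n → fun n ≡ n
open FinPerm public

_≈ₚ_ : FinPerm → FinPerm → Set
ω ≈ₚ ω' = ∀ n → fun ω n ≡ fun ω' n

s : ℕ → ℕ → ℕ
s i x = if x ≡ᵇ i then suc i else (if x ≡ᵇ suc i then i else x)

-- the permutation s_{α₁} ⋯ s_{αₗ} (rightmost factor applied first)
evalWord : List ℕ → ℕ → ℕ
evalWord []      x = x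
evalWord (a ∷ w) x = s a (evalWord w x)

Represents : List ℕ → FinPerm → Set
Represents w ω = All (λ a → 1 ≤ a) w × (∀ x → evalWord w x ≡ fun ω x)

IsReducedWord : List ℕ → FinPerm → Set
IsReducedWord w ω =
  Represents w ω × (∀ w' → Represents w' ω → length w ≤ length w')

Cells : Set
Cells = ℕ → ℕ → Bool

∅ : Cells
∅ _ _ = false

insert : Cells → ℕ × ℕ → Cells
insert T (a , b) i j = T i j ∨ ((i ≡ᵇ a) ∧ (j ≡ᵇ b))

_≐_ : Cells → Cells → Set
T ≐ T' = ∀ i j → T i j ≡ T' i j

record IsTowerDiagram (T : Cells) : Set where
  field
    no-col-zero : ∀ j → T 0 j ≡ false
    down-closed : ∀ i j k → T i j ≡ true → k ≤ j → T i k ≡ true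
    finite      : Σ ℕ λ B → ∀ i j → T i j ≡ true → (i < B × j < B)

-- Sliding.  Slide T γ m r : the procedure P(γ, m) run on T has outcome r,
-- where r = just c means the result is T ∪ {c}, r = nothing means the
-- slide terminates without result.

NoDiag : Cells → ℕ → ℕ → Set
NoDiag T γ m = ∀ i → m ≤ i → i ≤ γ ∸ 1 → T i (γ ∸ 1 ∸ i) ≡ false

FirstDiag : Cells → ℕ → ℕ → ℕ → Set
FirstDiag T γ m i =
  m ≤ i × i ≤ γ ∸ 1 × T i (γ ∸ 1 ∸ i) ≡ true ×
  (∀ k → m ≤ k → k < i → T k (γ ∸ 1 ∸ k) ≡ false)

data Slide (T : Cells) : ℕ → ℕ → Maybe (ℕ × ℕ) → Set where
  s1a : ∀ {γ m} → NoDiag T γ m → T γ 0 ≡ false →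
        Slide T γ m (just (γ , 0))
  s1b : ∀ {γ m} → NoDiag T γ m → T γ 0 ≡ true → T γ 1 ≡ false →
        Slide T γ m nothing
  s1c : ∀ {γ m r} → NoDiag T γ m → T γ 0 ≡ true → T γ 1 ≡ true →
        Slide T (suc γ) (suc γ) r → Slide T γ m r
  s2a : ∀ {γ m i} → FirstDiag T γ m i → T i (γ ∸ i) ≡ false →
        Slide T γ m (just (i , γ ∸ i))
  s2b : ∀ {γ m i} → FirstDiag T γ m i → T i (γ ∸ i) ≡ true →
        T i (suc (γ ∸ i)) ≡ false → Slide T γ m nothing
  s2c : ∀ {γ m i r} → FirstDiag T γ m i → T i (γ ∸ i) ≡ true →
        T i (suc (γ ∸ i)) ≡ true →
        Slide T (suc γ) (suc i) r → Slide T γ m r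

SlideInto : ℕ → Cells → ℕ × ℕ → Set
SlideInto α T c = Slide T α 1 (just c)

data TowerFrom : Cells → List ℕ → Cells → Set where
  done : ∀ {T} → TowerFrom T [] T
  step : ∀ {T α w c T'} → SlideInto α T c →
         TowerFrom (insert T c) w T' → TowerFrom T (α ∷ w) T'

WordTower : List ℕ → Cells → Set
WordTower w T = TowerFrom ∅ w T

{-# OPTIONS --safe #-}
-- Write π = ω⁻¹. The diagram 𝒯_ω turns out to have column i of height #{j > i : π j < π i}: it is the
-- Lehmer code of π drawn as towers. If ω α < ω (α + 1), then ω s_α has the same code except that column
-- ω α grows by one cell, and sliding α into the diagram of ω stops exactly on that cell. Each letter changes
-- the number of cells by one, the identity has none, and descending along descents reaches the identity in
-- as many steps as there are cells; so the cell count is the length, every letter of a reduced word adds a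
-- cell, and every reduced word of ω slides out the code diagram of ω. The code determines π column by
-- column, and every diagram is a code diagram: remove the top cell of its first nonempty column a,
-- realise the rest by some ω₀, and multiply by s_α for α = ω₀⁻¹ a.
module Submission where

open import Defs
open import Data.Bool using (true; false; T; if_then_else_; _∨_)
open import Data.Bool.Properties using (∨-identityʳ; not-¬)
open import Data.Empty using (⊥-elim)
open import Data.List using (List; []; _∷_; _++_; _∷ʳ_; length; [_])
open import Data.List.Properties using (length-++)
open import Data.List.Relation.Unary.All using (All; []; _∷_)
import Data.List.Relation.Unary.All as All
open import Data.List.Relation.Unary.All.Properties using (∷ʳ⁺)
open import Data.Maybe using (just)
open import Data.Nat
  using ( ℕ; zero; suc; pred; _+_; _∸_; _⊔_; _≤_; _<_; _<ᵇ_; _≡ᵇ_; z≤n; s≤s; s≤s⁻¹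
        ; _≟_; _<?_; _≤?_; >-nonZero )
open import Data.Nat.Induction using (<-rec)
open import Data.Nat.Properties
open import Algebra.Properties.CommutativeSemigroup +-commutativeSemigroup using (interchange)
open import Data.Product using (_×_; Σ; _,_; proj₁; proj₂)
open import Data.Sum using (_⊎_; inj₁; inj₂)
open import Function using (_∘_)
open import Function.Definitions using (Injective)
open import Relation.Binary using (tri<; tri≈; tri>)
open import Relation.Binary.PropositionalEquality hiding ([_])
open import Relation.Nullary using (¬_; Dec; yes; no; _×-dec_)

-- Counting with Iverson brackets

<⇒<ᵇ≡true : ∀ {m n} → m < n → (m <ᵇ n) ≡ true
<⇒<ᵇ≡true {m} {n} m<n with m <ᵇ n in eq
... | true  = refl
... | false = ⊥-elim (subst T eq (<⇒<ᵇ m<n))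

≥⇒<ᵇ≡false : ∀ {m n} → n ≤ m → (m <ᵇ n) ≡ false
≥⇒<ᵇ≡false {m} {n} n≤m with m <ᵇ n in eq
... | false = refl
... | true  = ⊥-elim (<⇒≱ (<ᵇ⇒< m n (subst T (sym eq) _)) n≤m)

<ᵇ≡true⇒< : ∀ {m n} → (m <ᵇ n) ≡ true → m < n
<ᵇ≡true⇒< {m} {n} eq = <ᵇ⇒< m n (subst T (sym eq) _)

≡⇒≡ᵇ≡true : ∀ {m n} → m ≡ n → (m ≡ᵇ n) ≡ true
≡⇒≡ᵇ≡true {m} refl with m ≡ᵇ m in eq
... | true  = refl
... | false = ⊥-elim (subst T eq (≡⇒≡ᵇ m m refl))

≢⇒≡ᵇ≡false : ∀ {m n} → m ≢ n → (m ≡ᵇ n) ≡ false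
≢⇒≡ᵇ≡false {m} {n} m≢n with m ≡ᵇ n in eq
... | false = refl
... | true  = ⊥-elim (m≢n (≡ᵇ⇒≡ m n (subst T (sym eq) _)))

abstract
  ⟦_<_⟧ : ℕ → ℕ → ℕ
  ⟦ x < y ⟧ = if x <ᵇ y then 1 else 0

  ⟦<⟧≡1 : ∀ {x y} → x < y → ⟦ x < y ⟧ ≡ 1
  ⟦<⟧≡1 x<y rewrite <⇒<ᵇ≡true x<y = refl

  ⟦<⟧≡0 : ∀ {x y} → y ≤ x → ⟦ x < y ⟧ ≡ 0
  ⟦<⟧≡0 y≤x rewrite ≥⇒<ᵇ≡false y≤x = refl

  ⟦<⟧≤1 : ∀ x y → ⟦ x < y ⟧ ≤ 1
  ⟦<⟧≤1 x y with x <ᵇ y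
  ... | true  = ≤-refl
  ... | false = z≤n

  ⟦_∈[_,_⟩⟧ : ℕ → ℕ → ℕ → ℕ
  ⟦ x ∈[ lo , hi ⟩⟧ = if x <ᵇ lo then 0 else ⟦ x < hi ⟧

  ⟦∈⟧≡1 : ∀ {lo x hi} → lo ≤ x → x < hi → ⟦ x ∈[ lo , hi ⟩⟧ ≡ 1
  ⟦∈⟧≡1 lo≤x x<hi rewrite ≥⇒<ᵇ≡false lo≤x = ⟦<⟧≡1 x<hi

  ⟦∈⟧≡0ˡ : ∀ {lo x hi} → x < lo → ⟦ x ∈[ lo , hi ⟩⟧ ≡ 0
  ⟦∈⟧≡0ˡ x<lo rewrite <⇒<ᵇ≡true x<lo = refl

  ⟦∈⟧≡0ʳ : ∀ {lo x hi} → hi ≤ x → ⟦ x ∈[ lo , hi ⟩⟧ ≡ 0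
  ⟦∈⟧≡0ʳ {lo} {x} hi≤x with x <ᵇ lo
  ... | true  = refl
  ... | false = ⟦<⟧≡0 hi≤x

∑< : ℕ → (ℕ → ℕ) → ℕ
∑< zero    f = 0
∑< (suc n) f = f n + ∑< n f

syntax ∑< n (λ j → e) = ∑[ j < n ] e

module _ {f g : ℕ → ℕ} where

  ∑-mono-≤ : ∀ n → (∀ j → j < n → f j ≤ g j) → ∑< n f ≤ ∑< n g
  ∑-mono-≤ zero    f≤g = z≤n
  ∑-mono-≤ (suc n) f≤g = +-mono-≤ (f≤g n ≤-refl) (∑-mono-≤ n (λ j j<n → f≤g j (m<n⇒m<1+n j<n)))

  ∑-cong : ∀ n → (∀ j → j < n → f j ≡ g j) → ∑< n f ≡ ∑< n g
  ∑-cong zero    f≡g = refl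
  ∑-cong (suc n) f≡g = cong₂ _+_ (f≡g n ≤-refl) (∑-cong n (λ j j<n → f≡g j (m<n⇒m<1+n j<n)))

  ∑-distrib-+ : ∀ n → ∑[ j < n ] (f j + g j) ≡ ∑< n f + ∑< n g
  ∑-distrib-+ zero    = refl
  ∑-distrib-+ (suc n) rewrite ∑-distrib-+ n = interchange (f n) (g n) (∑< n f) (∑< n g)

∑-mono-≤-+ : ∀ {f g h} n → (∀ j → j < n → f j ≤ g j + h j) → ∑< n f ≤ ∑< n g + ∑< n h
∑-mono-≤-+ {f} {g} {h} n f≤g+h = ≤-trans (∑-mono-≤ n f≤g+h) (≤-reflexive (∑-distrib-+ n))

∑-1 : ∀ n → ∑[ j < n ] 1 ≡ n
∑-1 zero    = refl
∑-1 (suc n) = cong suc (∑-1 n)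

∑-zero : ∀ {f} n → (∀ j → j < n → f j ≡ 0) → ∑< n f ≡ 0
∑-zero zero    f≡0 = refl
∑-zero (suc n) f≡0 rewrite f≡0 n ≤-refl = ∑-zero n (λ j j<n → f≡0 j (m<n⇒m<1+n j<n))

∑≡0⇒zero : ∀ {f} n → ∑< n f ≡ 0 → ∀ j → j < n → f j ≡ 0
∑≡0⇒zero {f} (suc n) ∑≡0 j j<1+n with f n in fn | m≤n⇒m<n∨m≡n (s≤s⁻¹ j<1+n)
... | zero | inj₁ j<n = ∑≡0⇒zero n ∑≡0 j j<n
... | zero | inj₂ refl = fn

∑-bump : ∀ {f f'} n a → a < n → (∀ j → j < n → j ≢ a → f' j ≡ f j) → f' a ≡ suc (f a) →
         ∑< n f' ≡ suc (∑< n f)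
∑-bump (suc n) a a<1+n same bumped with m≤n⇒m<n∨m≡n (s≤s⁻¹ a<1+n)
... | inj₁ a<n rewrite same n ≤-refl (λ n≡a → <-irrefl (sym n≡a) a<n) =
      trans (cong (_ +_) (∑-bump n a a<n (λ j j<n → same j (m<n⇒m<1+n j<n)) bumped)) (+-suc _ _)
... | inj₂ refl rewrite bumped =
      cong (λ z → suc (_ + z)) (∑-cong n (λ j j<n → same j (m<n⇒m<1+n j<n) (λ j≡n → <-irrefl j≡n j<n)))

∑-extend-zeros : ∀ {f} n t → (∀ j → n ≤ j → f j ≡ 0) → ∑< (t + n) f ≡ ∑< n f
∑-extend-zeros n zero    f≡0 = refl
∑-extend-zeros n (suc t) f≡0 rewrite f≡0 (t + n) (m≤n+m n t) = ∑-extend-zeros n t f≡0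

⟦∈⟧-split : ∀ lo hi {x y} → y ≢ x →
            ⟦ y ∈[ lo , hi ⟩⟧ ≤ ⟦ y ∈[ lo , x ⟩⟧ + ⟦ y ∈[ suc x , hi ⟩⟧
⟦∈⟧-split lo hi {x} {y} y≢x with y <? lo | y <? hi | <-cmp y x
... | yes y<lo | _ | _ rewrite ⟦∈⟧≡0ˡ {lo} {y} {hi} y<lo = z≤n
... | no _ | no y≮hi | _ rewrite ⟦∈⟧≡0ʳ {lo} {y} {hi} (≮⇒≥ y≮hi) = z≤n
... | no y≮lo | yes y<hi | tri< y<x _ _
  rewrite ⟦∈⟧≡1 (≮⇒≥ y≮lo) y<hi | ⟦∈⟧≡1 (≮⇒≥ y≮lo) y<x = s≤s z≤n
... | no _ | yes _ | tri≈ _ y≡x _ = ⊥-elim (y≢x y≡x)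
... | no y≮lo | yes y<hi | tri> _ _ x<y
  rewrite ⟦∈⟧≡1 (≮⇒≥ y≮lo) y<hi | ⟦∈⟧≡1 x<y y<hi = m≤n+m 1 _

∸-split : ∀ {lo x hi} → lo ≤ x → x < hi → 1 + ((x ∸ lo) + (hi ∸ suc x)) ≡ hi ∸ lo
∸-split {lo} {x} {hi} lo≤x x<hi = begin
  1 + ((x ∸ lo) + (hi ∸ suc x))  ≡⟨ cong suc (+-comm (x ∸ lo) (hi ∸ suc x)) ⟩
  suc ((hi ∸ suc x) + (x ∸ lo))  ≡⟨ +-suc (hi ∸ suc x) (x ∸ lo) ⟨
  (hi ∸ suc x) + suc (x ∸ lo)    ≡⟨ cong ((hi ∸ suc x) +_) (+-∸-assoc 1 lo≤x) ⟨
  (hi ∸ suc x) + (suc x ∸ lo)    ≡⟨ +-∸-assoc (hi ∸ suc x) (m≤n⇒m≤1+n lo≤x) ⟨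
  (hi ∸ suc x) + suc x ∸ lo      ≡⟨ cong (_∸ lo) (m∸n+n≡m x<hi) ⟩
  hi ∸ lo                        ∎
  where open ≡-Reasoning

-- An injective f takes at most hi ∸ lo values in [lo, hi): split [lo, hi) at the newest value f n.
count-∈-≤ : ∀ {f} → Injective _≡_ _≡_ f → ∀ n lo hi → ∑[ j < n ] ⟦ f j ∈[ lo , hi ⟩⟧ ≤ hi ∸ lo
count-∈-≤ f-inj zero lo hi = z≤n
count-∈-≤ {f} f-inj (suc n) lo hi with f n <? lo | f n <? hi
... | yes x<lo | _ rewrite ⟦∈⟧≡0ˡ {lo} {f n} {hi} x<lo = count-∈-≤ f-inj n lo hi
... | no _ | no x≮hi rewrite ⟦∈⟧≡0ʳ {lo} {f n} {hi} (≮⇒≥ x≮hi) = count-∈-≤ f-inj n lo hi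
... | no x≮lo | yes x<hi rewrite ⟦∈⟧≡1 (≮⇒≥ x≮lo) x<hi = begin
  1 + ∑[ j < n ] ⟦ f j ∈[ lo , hi ⟩⟧
    ≤⟨ +-monoʳ-≤ 1 (∑-mono-≤-+ n (λ j j<n → ⟦∈⟧-split lo hi (λ fj≡fn → <-irrefl (f-inj fj≡fn) j<n))) ⟩
  1 + (∑[ j < n ] ⟦ f j ∈[ lo , f n ⟩⟧ + ∑[ j < n ] ⟦ f j ∈[ suc (f n) , hi ⟩⟧)
    ≤⟨ +-monoʳ-≤ 1 (+-mono-≤ (count-∈-≤ f-inj n lo (f n)) (count-∈-≤ f-inj n (suc (f n)) hi)) ⟩
  1 + ((f n ∸ lo) + (hi ∸ suc (f n)))
    ≡⟨ ∸-split (≮⇒≥ x≮lo) x<hi ⟩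
  hi ∸ lo ∎
  where open ≤-Reasoning

-- Adjacent transpositions and finite permutations

s-left : ∀ a → s a a ≡ suc a
s-left a rewrite ≡⇒≡ᵇ≡true {a} refl = refl

s-right : ∀ a → s a (suc a) ≡ a
s-right a rewrite ≢⇒≡ᵇ≡false {suc a} {a} 1+n≢n | ≡⇒≡ᵇ≡true {suc a} refl = refl

s-other : ∀ {a x} → x ≢ a → x ≢ suc a → s a x ≡ x
s-other x≢a x≢1+a rewrite ≢⇒≡ᵇ≡false x≢a | ≢⇒≡ᵇ≡false x≢1+a = refl

s-involutive : ∀ a x → s a (s a x) ≡ x
s-involutive a x with x ≟ a | x ≟ suc a
... | yes refl | _ rewrite s-left a = s-right a
... | no _ | yes refl rewrite s-right a = s-left a
... | no x≢a | no x≢1+a rewrite s-other x≢a x≢1+a = s-other x≢a x≢1+a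

s-fixes-≥ : ∀ a x → 2 + a ≤ x → s a x ≡ x
s-fixes-≥ a x 2+a≤x = s-other (λ x≡a → <-irrefl (sym x≡a) (≤-trans (n≤1+n _) 2+a≤x))
                              (λ x≡1+a → <-irrefl (sym x≡1+a) 2+a≤x)

⟦<⟧-s-other : ∀ {a y} x → y ≢ a → y ≢ suc a → ⟦ y < s a x ⟧ ≡ ⟦ y < x ⟧
⟦<⟧-s-other {a} {y} x y≢a y≢1+a with x ≟ a | x ≟ suc a
... | yes refl | _ rewrite s-left a with <-cmp y x
...   | tri< y<x _ _ = trans (⟦<⟧≡1 (m<n⇒m<1+n y<x)) (sym (⟦<⟧≡1 y<x))
...   | tri≈ _ y≡x _ = ⊥-elim (y≢a y≡x)
...   | tri> _ _ x<y = trans (⟦<⟧≡0 x<y) (sym (⟦<⟧≡0 (<⇒≤ x<y)))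
⟦<⟧-s-other {a} {y} x y≢a y≢1+a | no _ | yes refl rewrite s-right a with <-cmp y a
...   | tri< y<a _ _ = trans (⟦<⟧≡1 y<a) (sym (⟦<⟧≡1 (m<n⇒m<1+n y<a)))
...   | tri≈ _ y≡a _ = ⊥-elim (y≢a y≡a)
...   | tri> _ _ a<y = trans (⟦<⟧≡0 (<⇒≤ a<y)) (sym (⟦<⟧≡0 a<y))
⟦<⟧-s-other {a} {y} x y≢a y≢1+a | no x≢a | no x≢1+a rewrite s-other x≢a x≢1+a = refl

⟦1+a<⟧ : ∀ a x → x ≢ suc a → ⟦ suc a < x ⟧ ≡ ⟦ a < x ⟧
⟦1+a<⟧ a x x≢1+a with <-cmp a x
... | tri< a<x _ _ = trans (⟦<⟧≡1 (≤∧≢⇒< a<x (x≢1+a ∘ sym))) (sym (⟦<⟧≡1 a<x))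
... | tri≈ _ refl _ = trans (⟦<⟧≡0 (n≤1+n a)) (sym (⟦<⟧≡0 ≤-refl))
... | tri> _ _ x<a = trans (⟦<⟧≡0 (m≤n⇒m≤1+n (<⇒≤ x<a))) (sym (⟦<⟧≡0 (<⇒≤ x<a)))

inv-injective : ∀ ω → Injective _≡_ _≡_ (inv ω)
inv-injective ω {x} {y} eq = trans (sym (fun-inv ω x)) (trans (cong (fun ω) eq) (fun-inv ω y))

fun-injective : ∀ ω → Injective _≡_ _≡_ (fun ω)
fun-injective ω {x} {y} eq = trans (sym (inv-fun ω x)) (trans (cong (inv ω) eq) (inv-fun ω y))

inv-zero : ∀ ω → inv ω 0 ≡ 0
inv-zero ω = trans (cong (inv ω) (sym (fix-zero ω))) (inv-fun ω 0)

≈ₚ-inv : ∀ {ω ω'} → ω ≈ₚ ω' → ∀ x → inv ω x ≡ inv ω' x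
≈ₚ-inv {ω} {ω'} ω≈ω' x =
  trans (sym (inv-fun ω' (inv ω x))) (cong (inv ω') (trans (sym (ω≈ω' (inv ω x))) (fun-inv ω x)))

≈ₚ-sym : ∀ {ω ω'} → ω ≈ₚ ω' → ω' ≈ₚ ω
≈ₚ-sym ω≈ω' x = sym (ω≈ω' x)

≈ₚ-trans : ∀ {ω ω' ω''} → ω ≈ₚ ω' → ω' ≈ₚ ω'' → ω ≈ₚ ω''
≈ₚ-trans ω≈ω' ω'≈ω'' x = trans (ω≈ω' x) (ω'≈ω'' x)

record Fixes (N : ℕ) (ω : FinPerm) : Set where
  constructor fixing
  field fixes : ∀ x → N ≤ x → fun ω x ≡ x
open Fixes

Fixes-support : ∀ ω → Fixes (proj₁ (support ω)) ω
Fixes-support ω = fixing (proj₂ (support ω))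

Fixes-mono : ∀ {N N' ω} → N ≤ N' → Fixes N ω → Fixes N' ω
Fixes-mono N≤N' F = fixing (λ x N'≤x → fixes F x (≤-trans N≤N' N'≤x))

inv-fixes : ∀ {N ω} → Fixes N ω → ∀ x → N ≤ x → inv ω x ≡ x
inv-fixes {N} {ω} F x N≤x = trans (cong (inv ω) (sym (fixes F x N≤x))) (inv-fun ω x)

fun-< : ∀ {N ω} → Fixes N ω → ∀ x → x < N → fun ω x < N
fun-< {N} {ω} F x x<N = ≰⇒> (λ N≤ωx →
  <⇒≱ x<N (subst (N ≤_) (trans (sym (inv-fixes F (fun ω x) N≤ωx)) (inv-fun ω x)) N≤ωx))

inv-< : ∀ {N ω} → Fixes N ω → ∀ x → x < N → inv ω x < N
inv-< {N} {ω} F x x<N = ≰⇒> (λ N≤ω⁻¹x →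
  <⇒≱ x<N (subst (N ≤_) (trans (sym (fixes F (inv ω x) N≤ω⁻¹x)) (fun-inv ω x)) N≤ω⁻¹x))

idₚ : FinPerm
idₚ = record
  { fun = λ x → x ; inv = λ x → x ; fun-inv = λ _ → refl ; inv-fun = λ _ → refl
  ; fix-zero = refl ; support = 0 , λ _ _ → refl }

Fixes-idₚ : ∀ N → Fixes N idₚ
Fixes-idₚ N = fixing (λ _ _ → refl)

infixl 25 _∙_ _·_

-- ω ∙ a is ω s_a. The letter 0 acts as the identity, since s 0 would move 0.
_∙_ : FinPerm → ℕ → FinPerm
ω ∙ zero  = ω
ω ∙ suc a = record
  { fun      = λ x → fun ω (s (suc a) x)
  ; inv      = λ x → s (suc a) (inv ω x)
  ; fun-inv  = λ x → trans (cong (fun ω) (s-involutive (suc a) (inv ω x))) (fun-inv ω x)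
  ; inv-fun  = λ x → trans (cong (s (suc a)) (inv-fun ω (s (suc a) x))) (s-involutive (suc a) x)
  ; fix-zero = fix-zero ω
  ; support  = proj₁ (support ω) ⊔ (3 + a) , λ x ≤x →
      trans (cong (fun ω) (s-fixes-≥ (suc a) x (≤-trans (m≤n⊔m _ _) ≤x)))
            (proj₂ (support ω) x (≤-trans (m≤m⊔n _ _) ≤x)) }

Fixes-∙ : ∀ {N ω} a → 2 + a ≤ N → Fixes N ω → Fixes N (ω ∙ a)
Fixes-∙ zero    _     F = F
Fixes-∙ {ω = ω} (suc a) 3+a≤N F =
  fixing (λ x N≤x → trans (cong (fun ω) (s-fixes-≥ (suc a) x (≤-trans 3+a≤N N≤x))) (fixes F x N≤x))

∙-involutive : ∀ ω a → (ω ∙ a) ∙ a ≈ₚ ω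
∙-involutive ω zero    x = refl
∙-involutive ω (suc a) x = cong (fun ω) (s-involutive (suc a) x)

_·_ : FinPerm → List ℕ → FinPerm
ω · []      = ω
ω · (a ∷ w) = (ω ∙ a) · w

·-++ : ∀ ω u v → ω · (u ++ v) ≡ (ω · u) · v
·-++ ω []      v = refl
·-++ ω (a ∷ u) v = ·-++ (ω ∙ a) u v

fun-· : ∀ ω w → All (1 ≤_) w → ∀ x → fun (ω · w) x ≡ fun ω (evalWord w x)
fun-· ω []          []             x = refl
fun-· ω (suc a ∷ w) (_ ∷ positive) x = fun-· (ω ∙ suc a) w positive x

-- every letter a is positive and s_a moves only points below N
LettersBelow : ℕ → List ℕ → Set
LettersBelow N w = All (λ a → 1 ≤ a × 2 + a ≤ N) w

-- The code diagram

countAbove : (ℕ → ℕ) → ℕ → ℕ → ℕ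
countAbove f n y = ∑[ j < n ] ⟦ y < f j ⟧

countAbove-≤ : ∀ f n y → countAbove f n y ≤ n
countAbove-≤ f n y = ≤-trans (∑-mono-≤ n (λ j _ → ⟦<⟧≤1 y (f j))) (≤-reflexive (∑-1 n))

module _ {f : ℕ → ℕ} (f-inj : Injective _≡_ _≡_ f) where

  ≤-+-countAbove : ∀ n {y} → (∀ j → j < n → f j ≢ y) → n ≤ y + countAbove f n y
  ≤-+-countAbove n {y} y∉ = begin
    n                                                  ≡⟨ ∑-1 n ⟨
    ∑[ j < n ] 1                                       ≤⟨ ∑-mono-≤-+ n above-or-below ⟩
    countAbove f n y + ∑[ j < n ] ⟦ f j ∈[ 0 , y ⟩⟧    ≤⟨ +-monoʳ-≤ _ (count-∈-≤ f-inj n 0 y) ⟩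
    countAbove f n y + y                               ≡⟨ +-comm _ y ⟩
    y + countAbove f n y                               ∎
    where
    open ≤-Reasoning
    above-or-below : ∀ j → j < n → 1 ≤ ⟦ y < f j ⟧ + ⟦ f j ∈[ 0 , y ⟩⟧
    above-or-below j j<n with <-cmp y (f j)
    ... | tri< y<fj _ _ rewrite ⟦<⟧≡1 y<fj = s≤s z≤n
    ... | tri≈ _ y≡fj _ = ⊥-elim (y∉ j j<n (sym y≡fj))
    ... | tri> _ _ fj<y rewrite ⟦<⟧≡0 (<⇒≤ fj<y) | ⟦∈⟧≡1 z≤n fj<y = s≤s z≤n

  -- A value above x is above y or one of the y ∸ suc x values strictly between (y itself is not taken).
  +-countAbove-< : ∀ n {x y} → x < y → (∀ j → j < n → f j ≢ y) →
                   x + countAbove f n x < y + countAbove f n y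
  +-countAbove-< n {x} {y} x<y y∉ = begin-strict
    x + countAbove f n x
      ≤⟨ +-monoʳ-≤ x (∑-mono-≤-+ n above-x) ⟩
    x + (countAbove f n y + ∑[ j < n ] ⟦ f j ∈[ suc x , y ⟩⟧)
      ≤⟨ +-monoʳ-≤ x (+-monoʳ-≤ _ (count-∈-≤ f-inj n (suc x) y)) ⟩
    x + (countAbove f n y + (y ∸ suc x))
      <⟨ n<1+n _ ⟩
    suc (x + (countAbove f n y + (y ∸ suc x)))
      ≡⟨ ∸-absorb x<y ⟩
    y + countAbove f n y ∎
    where
    open ≤-Reasoning
    above-x : ∀ j → j < n → ⟦ x < f j ⟧ ≤ ⟦ y < f j ⟧ + ⟦ f j ∈[ suc x , y ⟩⟧
    above-x j j<n with <-cmp x (f j)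
    ... | tri≈ _ x≡fj _ rewrite ⟦<⟧≡0 (≤-reflexive (sym x≡fj)) = z≤n
    ... | tri> _ _ fj<x rewrite ⟦<⟧≡0 (<⇒≤ fj<x) = z≤n
    ... | tri< x<fj _ _ with <-cmp y (f j)
    ...   | tri< y<fj _ _ rewrite ⟦<⟧≡1 x<fj | ⟦<⟧≡1 y<fj = s≤s z≤n
    ...   | tri≈ _ y≡fj _ = ⊥-elim (y∉ j j<n (sym y≡fj))
    ...   | tri> _ _ fj<y rewrite ⟦<⟧≡1 x<fj | ⟦∈⟧≡1 x<fj fj<y = m≤n+m 1 _
    ∸-absorb : ∀ {x y c} → x < y → suc (x + (c + (y ∸ suc x))) ≡ y + c
    ∸-absorb {x} {y} {c} x<y = begin-equality
      suc (x + (c + (y ∸ suc x)))  ≡⟨ cong (λ z → suc (x + z)) (+-comm c _) ⟩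
      suc (x + ((y ∸ suc x) + c))  ≡⟨ cong suc (+-assoc x _ c) ⟨
      suc x + (y ∸ suc x) + c      ≡⟨ cong (_+ c) (m+[n∸m]≡n x<y) ⟩
      y + c                        ∎

-- Column i of 𝒯_ω has height reach ω i ∸ i = #{j > i : ω⁻¹ j < ω⁻¹ i}; its top cell is on the diagonal reach ω i − 1.
reach : FinPerm → ℕ → ℕ
reach ω i = inv ω i + countAbove (inv ω) i (inv ω i)

towerOf : FinPerm → Cells
towerOf ω i k = (i + k) <ᵇ reach ω i

towerOf-at : ∀ ω {i k y} → i + k ≡ y → towerOf ω i k ≡ (y <ᵇ reach ω i)
towerOf-at ω i+k≡y = cong (_<ᵇ reach ω _) i+k≡y

cellCount : ℕ → FinPerm → ℕ
cellCount N ω = ∑[ i < N ] (reach ω i ∸ i)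

reach-zero : ∀ ω → reach ω 0 ≡ 0
reach-zero ω = trans (+-identityʳ _) (inv-zero ω)

≤-reach : ∀ ω i → i ≤ reach ω i
≤-reach ω i = ≤-+-countAbove (inv-injective ω) i (λ j j<i eq → <-irrefl (inv-injective ω eq) j<i)

reach-fixed : ∀ {N ω} → Fixes N ω → ∀ i → N ≤ i → reach ω i ≡ i
reach-fixed {N} {ω} F i N≤i
  rewrite inv-fixes F i N≤i = trans (cong (i +_) (∑-zero i nothing-above)) (+-identityʳ i)
  where
  nothing-above : ∀ j → j < i → ⟦ i < inv ω j ⟧ ≡ 0
  nothing-above j j<i with j <? N
  ... | yes j<N = ⟦<⟧≡0 (<⇒≤ (≤-trans (inv-< F j j<N) N≤i))
  ... | no j≮N rewrite inv-fixes F j (≮⇒≥ j≮N) = ⟦<⟧≡0 (<⇒≤ j<i)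

reach-cong : ∀ {ω ω'} → ω ≈ₚ ω' → ∀ i → reach ω i ≡ reach ω' i
reach-cong {ω} {ω'} ω≈ω' i = cong₂ _+_ (ω⁻¹≡ i) (∑-cong i (λ j _ → cong₂ ⟦_<_⟧ (ω⁻¹≡ i) (ω⁻¹≡ j)))
  where
  ω⁻¹≡ : ∀ x → inv ω x ≡ inv ω' x
  ω⁻¹≡ = ≈ₚ-inv {ω} {ω'} ω≈ω'

towerOf-cong : ∀ {ω ω'} → ω ≈ₚ ω' → towerOf ω ≐ towerOf ω'
towerOf-cong {ω} {ω'} ω≈ω' i k = cong ((i + k) <ᵇ_) (reach-cong {ω} {ω'} ω≈ω' i)

cellCount-cong : ∀ N {ω ω'} → ω ≈ₚ ω' → cellCount N ω ≡ cellCount N ω'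
cellCount-cong N {ω} {ω'} ω≈ω' = ∑-cong N (λ i _ → cong (_∸ i) (reach-cong {ω} {ω'} ω≈ω' i))

cellCount-stable : ∀ {N ω} t → Fixes N ω → cellCount (t + N) ω ≡ cellCount N ω
cellCount-stable {N} t F =
  ∑-extend-zeros N t (λ i N≤i → trans (cong (_∸ i) (reach-fixed F i N≤i)) (n∸n≡0 i))

reach-idₚ : ∀ i → reach idₚ i ≡ i
reach-idₚ i = reach-fixed (Fixes-idₚ 0) i z≤n

cellCount-idₚ : ∀ N → cellCount N idₚ ≡ 0
cellCount-idₚ N = ∑-zero N (λ i _ → trans (cong (_∸ i) (reach-idₚ i)) (n∸n≡0 i))

towerOf-idₚ : towerOf idₚ ≐ ∅
towerOf-idₚ i k = trans (cong ((i + k) <ᵇ_) (reach-idₚ i)) (≥⇒<ᵇ≡false (m≤m+n i k))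

towerOf-isTowerDiagram : ∀ ω → IsTowerDiagram (towerOf ω)
towerOf-isTowerDiagram ω = record
  { no-col-zero = λ j → trans (cong (j <ᵇ_) (reach-zero ω)) (≥⇒<ᵇ≡false {j} z≤n)
  ; down-closed = λ i j k ij∈ k≤j →
      <⇒<ᵇ≡true {i + k} {reach ω i} (≤-<-trans (+-monoʳ-≤ i k≤j) (<ᵇ≡true⇒< {i + j} {reach ω i} ij∈))
  ; finite      = N + N , bounded }
  where
  N = proj₁ (support ω)
  bounded : ∀ i j → towerOf ω i j ≡ true → i < N + N × j < N + N
  bounded i j ij∈ with i <? N
  ... | no i≮N = ⊥-elim (<-irrefl refl (<-≤-trans (<ᵇ≡true⇒< ij∈)
          (≤-trans (≤-reflexive (reach-fixed (Fixes-support ω) i (≮⇒≥ i≮N))) (m≤m+n i j))))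
  ... | yes i<N = ≤-trans i<N (m≤m+n N N) , ≤-<-trans (m≤n+m j i) (<-trans (<ᵇ≡true⇒< ij∈) reach<2N)
    where
    reach<2N : reach ω i < N + N
    reach<2N = +-mono-< (inv-< (Fixes-support ω) i i<N) (≤-<-trans (countAbove-≤ (inv ω) i (inv ω i)) i<N)

-- Multiplying by an ascent

module Ascent (ω : FinPerm) (a : ℕ) where

  α : ℕ
  α = suc a

  A B : ℕ
  A = fun ω α
  B = fun ω (suc α)

  inv-A : inv ω A ≡ α
  inv-A = inv-fun ω α

  inv-B : inv ω B ≡ suc α
  inv-B = inv-fun ω (suc α)

  ≡A : ∀ {i} → inv ω i ≡ α → i ≡ A
  ≡A {i} eq = trans (sym (fun-inv ω i)) (cong (fun ω) eq)

  ≡B : ∀ {i} → inv ω i ≡ suc α → i ≡ B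
  ≡B {i} eq = trans (sym (fun-inv ω i)) (cong (fun ω) eq)

  newCell : ℕ × ℕ
  newCell = A , reach ω A ∸ A

  reach-∙-untouched : ∀ i → i ≢ A → i ≢ B → reach (ω ∙ α) i ≡ reach ω i
  reach-∙-untouched i i≢A i≢B = cong₂ _+_ ω'⁻¹i≡ω⁻¹i (∑-cong i same-comparison)
    where
    ω⁻¹i≢α : inv ω i ≢ α
    ω⁻¹i≢α = i≢A ∘ ≡A
    ω⁻¹i≢1+α : inv ω i ≢ suc α
    ω⁻¹i≢1+α = i≢B ∘ ≡B
    ω'⁻¹i≡ω⁻¹i : s α (inv ω i) ≡ inv ω i
    ω'⁻¹i≡ω⁻¹i = s-other ω⁻¹i≢α ω⁻¹i≢1+α
    same-comparison : ∀ j → j < i → ⟦ s α (inv ω i) < s α (inv ω j) ⟧ ≡ ⟦ inv ω i < inv ω j ⟧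
    same-comparison j _ rewrite ω'⁻¹i≡ω⁻¹i = ⟦<⟧-s-other (inv ω j) ω⁻¹i≢α ω⁻¹i≢1+α

  module _ (A<B : A < B) where

    -- Column B loses α + 1 as ω⁻¹-value but gains the inversion with A.
    reach-∙-B : reach (ω ∙ α) B ≡ reach ω B
    reach-∙-B = begin
      s α (inv ω B) + ∑[ j < B ] ⟦ s α (inv ω B) < s α (inv ω j) ⟧
        ≡⟨ cong (λ z → s α z + ∑[ j < B ] ⟦ s α z < s α (inv ω j) ⟧) inv-B ⟩
      s α (suc α) + ∑[ j < B ] ⟦ s α (suc α) < s α (inv ω j) ⟧
        ≡⟨ cong (λ z → z + ∑[ j < B ] ⟦ z < s α (inv ω j) ⟧) (s-right α) ⟩
      α + ∑[ j < B ] ⟦ α < s α (inv ω j) ⟧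
        ≡⟨ cong (α +_) (∑-bump B A A<B off-A at-A) ⟩
      α + suc (∑[ j < B ] ⟦ suc α < inv ω j ⟧)
        ≡⟨ +-suc α _ ⟩
      suc α + ∑[ j < B ] ⟦ suc α < inv ω j ⟧
        ≡⟨ cong (λ z → z + ∑[ j < B ] ⟦ z < inv ω j ⟧) inv-B ⟨
      inv ω B + ∑[ j < B ] ⟦ inv ω B < inv ω j ⟧ ∎
      where
      open ≡-Reasoning
      off-A : ∀ j → j < B → j ≢ A → ⟦ α < s α (inv ω j) ⟧ ≡ ⟦ suc α < inv ω j ⟧
      off-A j j<B j≢A =
        trans (cong ⟦ α <_⟧ (s-other (j≢A ∘ ≡A) ω⁻¹j≢1+α)) (sym (⟦1+a<⟧ α (inv ω j) ω⁻¹j≢1+α))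
        where
        ω⁻¹j≢1+α : inv ω j ≢ suc α
        ω⁻¹j≢1+α eq = <-irrefl (≡B eq) j<B
      at-A : ⟦ α < s α (inv ω A) ⟧ ≡ suc ⟦ suc α < inv ω A ⟧
      at-A rewrite inv-A | s-left α = trans (⟦<⟧≡1 ≤-refl) (cong suc (sym (⟦<⟧≡0 (n≤1+n α))))

    reach-∙-A : reach (ω ∙ α) A ≡ suc (reach ω A)
    reach-∙-A = begin
      s α (inv ω A) + ∑[ j < A ] ⟦ s α (inv ω A) < s α (inv ω j) ⟧
        ≡⟨ cong (λ z → s α z + ∑[ j < A ] ⟦ s α z < s α (inv ω j) ⟧) inv-A ⟩
      s α α + ∑[ j < A ] ⟦ s α α < s α (inv ω j) ⟧
        ≡⟨ cong (λ z → z + ∑[ j < A ] ⟦ z < s α (inv ω j) ⟧) (s-left α) ⟩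
      suc α + ∑[ j < A ] ⟦ suc α < s α (inv ω j) ⟧
        ≡⟨ cong (suc α +_) (∑-cong A before-A) ⟩
      suc (α + ∑[ j < A ] ⟦ α < inv ω j ⟧)
        ≡⟨ cong (λ z → suc (z + ∑[ j < A ] ⟦ z < inv ω j ⟧)) inv-A ⟨
      suc (inv ω A + ∑[ j < A ] ⟦ inv ω A < inv ω j ⟧) ∎
      where
      open ≡-Reasoning
      before-A : ∀ j → j < A → ⟦ suc α < s α (inv ω j) ⟧ ≡ ⟦ α < inv ω j ⟧
      before-A j j<A =
        trans (cong ⟦ suc α <_⟧ (s-other ω⁻¹j≢α ω⁻¹j≢1+α)) (⟦1+a<⟧ α (inv ω j) ω⁻¹j≢1+α)
        where
        ω⁻¹j≢α : inv ω j ≢ α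
        ω⁻¹j≢α eq = <-irrefl (≡A eq) j<A
        ω⁻¹j≢1+α : inv ω j ≢ suc α
        ω⁻¹j≢1+α eq = <-irrefl (≡B eq) (<-trans j<A A<B)

    reach-∙-≢A : ∀ i → i ≢ A → reach (ω ∙ α) i ≡ reach ω i
    reach-∙-≢A i i≢A with i ≟ B
    ... | yes refl = reach-∙-B
    ... | no i≢B   = reach-∙-untouched i i≢A i≢B

    towerOf-∙ : towerOf (ω ∙ α) ≐ insert (towerOf ω) newCell
    towerOf-∙ i k with i ≟ A
    ... | no i≢A rewrite reach-∙-≢A i i≢A | ≢⇒≡ᵇ≡false i≢A = sym (∨-identityʳ _)
    ... | yes refl rewrite reach-∙-A | ≡⇒≡ᵇ≡true {A} refl with <-cmp (A + k) (reach ω A)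
    ...   | tri< below _ _ rewrite <⇒<ᵇ≡true below | <⇒<ᵇ≡true (m<n⇒m<1+n below) = refl
    ...   | tri≈ _ on-top _
            rewrite ≥⇒<ᵇ≡false (≤-reflexive (sym on-top)) | <⇒<ᵇ≡true (≤-reflexive (cong suc on-top)) =
            sym (≡⇒≡ᵇ≡true (trans (sym (m+n∸m≡n A k)) (cong (_∸ A) on-top)))
    ...   | tri> _ _ above rewrite ≥⇒<ᵇ≡false (<⇒≤ above) | ≥⇒<ᵇ≡false above =
            sym (≢⇒≡ᵇ≡false (λ k≡ → <-irrefl (trans (sym (m+[n∸m]≡n (≤-reach ω A))) (cong (A +_) (sym k≡)))
                                               above))

    cellCount-∙ : ∀ N → A < N → cellCount N (ω ∙ α) ≡ suc (cellCount N ω)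
    cellCount-∙ N A<N = ∑-bump N A A<N (λ j _ j≢A → cong (_∸ j) (reach-∙-≢A j j≢A))
      (trans (cong (_∸ A) reach-∙-A) (+-∸-assoc 1 (≤-reach ω A)))

-- Sliding

≐-sym : ∀ {T T'} → T ≐ T' → T' ≐ T
≐-sym T≐T' i j = sym (T≐T' i j)

≐-trans : ∀ {T T' T''} → T ≐ T' → T' ≐ T'' → T ≐ T''
≐-trans T≐T' T'≐T'' i j = trans (T≐T' i j) (T'≐T'' i j)

insert-cong : ∀ {T T'} c → T ≐ T' → insert T c ≐ insert T' c
insert-cong c T≐T' i j = cong (_∨ _) (T≐T' i j)

IsTowerDiagram-resp-≐ : ∀ {T T'} → T ≐ T' → IsTowerDiagram T → IsTowerDiagram T'
IsTowerDiagram-resp-≐ {T} {T'} T≐T' td = record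
  { no-col-zero = λ j → trans (sym (T≐T' 0 j)) (no-col-zero j)
  ; down-closed = λ i j k ij∈ k≤j → trans (sym (T≐T' i k)) (down-closed i j k (trans (T≐T' i j) ij∈) k≤j)
  ; finite      = proj₁ finite , λ i j ij∈ → proj₂ finite i j (trans (T≐T' i j) ij∈) }
  where open IsTowerDiagram td

Slide-resp-≐ : ∀ {T T' γ m r} → T ≐ T' → Slide T γ m r → Slide T' γ m r
Slide-resp-≐ {T} {T'} T≐T' = go
  where
  move : ∀ {i j b} → T i j ≡ b → T' i j ≡ b
  move {i} {j} eq = trans (sym (T≐T' i j)) eq
  noDiag : ∀ {γ m} → NoDiag T γ m → NoDiag T' γ m
  noDiag none i m≤i i≤ = move (none i m≤i i≤)
  firstDiag : ∀ {γ m i} → FirstDiag T γ m i → FirstDiag T' γ m i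
  firstDiag (m≤i , i≤ , hit , miss) = m≤i , i≤ , move hit , λ k m≤k k<i → move (miss k m≤k k<i)
  go : ∀ {γ m r} → Slide T γ m r → Slide T' γ m r
  go {γ} (s1a nd e)       = s1a (noDiag {γ} nd) (move e)
  go {γ} (s1b nd e e')    = s1b (noDiag {γ} nd) (move e) (move e')
  go {γ} (s1c nd e e' sl) = s1c (noDiag {γ} nd) (move e) (move e') (go sl)
  go {γ} (s2a fd e)       = s2a (firstDiag {γ} fd) (move e)
  go {γ} (s2b fd e e')    = s2b (firstDiag {γ} fd) (move e) (move e')
  go {γ} (s2c fd e e' sl) = s2c (firstDiag {γ} fd) (move e) (move e') (go sl)

module _ {T : Cells} where

  NoDiag-FirstDiag-exclusive : ∀ {γ m i} → NoDiag T γ m → ¬ FirstDiag T γ m i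
  NoDiag-FirstDiag-exclusive none (m≤i , i≤ , hit , _) = not-¬ hit (none _ m≤i i≤)

  FirstDiag-unique : ∀ {γ m i i'} → FirstDiag T γ m i → FirstDiag T γ m i' → i ≡ i'
  FirstDiag-unique {i = i} {i'} (m≤i , _ , hit , miss) (m≤i' , _ , hit' , miss') with <-cmp i i'
  ... | tri< i<i' _ _ = ⊥-elim (not-¬ hit (miss' i m≤i i<i'))
  ... | tri≈ _ i≡i' _ = i≡i'
  ... | tri> _ _ i'<i = ⊥-elim (not-¬ hit' (miss i' m≤i' i'<i))

  Slide-deterministic : ∀ {γ m r r'} → Slide T γ m r → Slide T γ m r' → r ≡ r'
  Slide-deterministic (s1a _ e)      (s1a _ _)        = refl
  Slide-deterministic (s1a _ e)      (s1b _ e' _)     = ⊥-elim (not-¬ e' e)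
  Slide-deterministic (s1a _ e)      (s1c _ e' _ _)   = ⊥-elim (not-¬ e' e)
  Slide-deterministic (s1b _ e _)    (s1a _ e')       = ⊥-elim (not-¬ e e')
  Slide-deterministic (s1b _ _ _)    (s1b _ _ _)      = refl
  Slide-deterministic (s1b _ _ e)    (s1c _ _ e' _)   = ⊥-elim (not-¬ e' e)
  Slide-deterministic (s1c _ e _ _)  (s1a _ e')       = ⊥-elim (not-¬ e e')
  Slide-deterministic (s1c _ _ e _)  (s1b _ _ e')     = ⊥-elim (not-¬ e e')
  Slide-deterministic (s1c _ _ _ sl) (s1c _ _ _ sl')  = Slide-deterministic sl sl'
  Slide-deterministic {γ} (s2a fd e)     (s2a fd' _)      with FirstDiag-unique {γ} fd fd'
  ... | refl = refl
  Slide-deterministic {γ} (s2a fd e)     (s2b fd' e' _)   with FirstDiag-unique {γ} fd fd'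
  ... | refl = ⊥-elim (not-¬ e' e)
  Slide-deterministic {γ} (s2a fd e)     (s2c fd' e' _ _) with FirstDiag-unique {γ} fd fd'
  ... | refl = ⊥-elim (not-¬ e' e)
  Slide-deterministic {γ} (s2b fd e _)   (s2a fd' e')     with FirstDiag-unique {γ} fd fd'
  ... | refl = ⊥-elim (not-¬ e e')
  Slide-deterministic (s2b _ _ _)    (s2b _ _ _)      = refl
  Slide-deterministic {γ} (s2b fd _ e)   (s2c fd' _ e' _) with FirstDiag-unique {γ} fd fd'
  ... | refl = ⊥-elim (not-¬ e' e)
  Slide-deterministic {γ} (s2c fd e _ _) (s2a fd' e')     with FirstDiag-unique {γ} fd fd'
  ... | refl = ⊥-elim (not-¬ e e')
  Slide-deterministic {γ} (s2c fd _ e _) (s2b fd' _ e')   with FirstDiag-unique {γ} fd fd'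
  ... | refl = ⊥-elim (not-¬ e e')
  Slide-deterministic {γ} (s2c fd _ _ sl) (s2c fd' _ _ sl') with FirstDiag-unique {γ} fd fd'
  ... | refl = Slide-deterministic sl sl'
  Slide-deterministic {γ} (s1a nd _)     (s2a fd _)       = ⊥-elim (NoDiag-FirstDiag-exclusive {γ} nd fd)
  Slide-deterministic {γ} (s1a nd _)     (s2b fd _ _)     = ⊥-elim (NoDiag-FirstDiag-exclusive {γ} nd fd)
  Slide-deterministic {γ} (s1a nd _)     (s2c fd _ _ _)   = ⊥-elim (NoDiag-FirstDiag-exclusive {γ} nd fd)
  Slide-deterministic {γ} (s1b nd _ _)   (s2a fd _)       = ⊥-elim (NoDiag-FirstDiag-exclusive {γ} nd fd)
  Slide-deterministic {γ} (s1b nd _ _)   (s2b fd _ _)     = ⊥-elim (NoDiag-FirstDiag-exclusive {γ} nd fd)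
  Slide-deterministic {γ} (s1b nd _ _)   (s2c fd _ _ _)   = ⊥-elim (NoDiag-FirstDiag-exclusive {γ} nd fd)
  Slide-deterministic {γ} (s1c nd _ _ _) (s2a fd _)       = ⊥-elim (NoDiag-FirstDiag-exclusive {γ} nd fd)
  Slide-deterministic {γ} (s1c nd _ _ _) (s2b fd _ _)     = ⊥-elim (NoDiag-FirstDiag-exclusive {γ} nd fd)
  Slide-deterministic {γ} (s1c nd _ _ _) (s2c fd _ _ _)   = ⊥-elim (NoDiag-FirstDiag-exclusive {γ} nd fd)
  Slide-deterministic {γ} (s2a fd _)     (s1a nd _)       = ⊥-elim (NoDiag-FirstDiag-exclusive {γ} nd fd)
  Slide-deterministic {γ} (s2a fd _)     (s1b nd _ _)     = ⊥-elim (NoDiag-FirstDiag-exclusive {γ} nd fd)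
  Slide-deterministic {γ} (s2a fd _)     (s1c nd _ _ _)   = ⊥-elim (NoDiag-FirstDiag-exclusive {γ} nd fd)
  Slide-deterministic {γ} (s2b fd _ _)   (s1a nd _)       = ⊥-elim (NoDiag-FirstDiag-exclusive {γ} nd fd)
  Slide-deterministic {γ} (s2b fd _ _)   (s1b nd _ _)     = ⊥-elim (NoDiag-FirstDiag-exclusive {γ} nd fd)
  Slide-deterministic {γ} (s2b fd _ _)   (s1c nd _ _ _)   = ⊥-elim (NoDiag-FirstDiag-exclusive {γ} nd fd)
  Slide-deterministic {γ} (s2c fd _ _ _) (s1a nd _)       = ⊥-elim (NoDiag-FirstDiag-exclusive {γ} nd fd)
  Slide-deterministic {γ} (s2c fd _ _ _) (s1b nd _ _)     = ⊥-elim (NoDiag-FirstDiag-exclusive {γ} nd fd)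
  Slide-deterministic {γ} (s2c fd _ _ _) (s1c nd _ _ _)   = ⊥-elim (NoDiag-FirstDiag-exclusive {γ} nd fd)

TowerFrom-functional : ∀ {T₀ T₁ w T T'} → T₀ ≐ T₁ → TowerFrom T₀ w T → TowerFrom T₁ w T' → T ≐ T'
TowerFrom-functional T₀≐T₁ done done = T₀≐T₁
TowerFrom-functional T₀≐T₁ (step sl tf) (step sl' tf')
  with Slide-deterministic (Slide-resp-≐ T₀≐T₁ sl) sl'
... | refl = TowerFrom-functional (insert-cong _ T₀≐T₁) tf tf'

module SlideAscent (ω : FinPerm) (a : ℕ) where
  open Ascent ω a

  tallBefore : ℕ → ℕ
  tallBefore m = countAbove (inv ω) m α

  ShortRun : ℕ → ℕ → Set
  ShortRun m i = ∀ j → m ≤ j → j < i → inv ω j < α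

  tallBefore-flat : ∀ {m} i → m ≤ i → ShortRun m i → tallBefore i ≡ tallBefore m
  tallBefore-flat zero    z≤n     _     = refl
  tallBefore-flat (suc i) m≤1+i short with m≤n⇒m<n∨m≡n m≤1+i
  ... | inj₂ refl = refl
  ... | inj₁ m≤i  = trans (cong (_+ tallBefore i) (⟦<⟧≡0 (<⇒≤ (short i (s≤s⁻¹ m≤i) ≤-refl))))
                          (tallBefore-flat i (s≤s⁻¹ m≤i) (λ j m≤j j<i → short j m≤j (m<n⇒m<1+n j<i)))

  α∉below : ∀ {i} → i ≤ A → ∀ j → j < i → inv ω j ≢ α
  α∉below i≤A j j<i eq = <-irrefl (≡A eq) (<-≤-trans j<i i≤A)

  ≤-α+tallBefore : ∀ i → i ≤ A → i ≤ α + tallBefore i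
  ≤-α+tallBefore i i≤A = ≤-+-countAbove (inv-injective ω) i (α∉below i≤A)

  reach-A : reach ω A ≡ α + tallBefore A
  reach-A = cong (λ z → z + countAbove (inv ω) A z) inv-A

  -- Columns j < A with ω⁻¹ j < α end below the diagonal of the sliding α; those with ω⁻¹ j > α + 1 stick out
  -- at least two cells above it and push it one diagonal up; column A ends exactly on it. So when the slide
  -- reaches column m, it runs along the diagonal α + tallBefore m − 1.
  Reaches : ℕ → Set
  Reaches m = Slide (towerOf ω) (α + tallBefore m) m (just newCell)

  module _ (A<B : A < B) where

    reach-short : ∀ j → j < A → inv ω j < α → suc (reach ω j) ≤ α + tallBefore j
    reach-short j j<A ω⁻¹j<α = +-countAbove-< (inv-injective ω) j ω⁻¹j<α (α∉below (<⇒≤ j<A))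

    reach-tall : ∀ i → i < A → ¬ inv ω i < α → 2 + α + tallBefore i ≤ reach ω i
    reach-tall i i<A ω⁻¹i≮α = subst (λ t → suc (suc α + t) ≤ reach ω i) no-1+α
      (+-countAbove-< (inv-injective ω) i 1+α<ω⁻¹i (λ j j<i eq → <-irrefl (inv-injective ω eq) j<i))
      where
      1+α<ω⁻¹i : suc α < inv ω i
      1+α<ω⁻¹i = ≤∧≢⇒< (≤∧≢⇒< (≮⇒≥ ω⁻¹i≮α) (λ eq → <-irrefl (≡A (sym eq)) i<A))
                        (λ eq → <-irrefl (≡B (sym eq)) (<-trans i<A A<B))
      no-1+α : countAbove (inv ω) i (suc α) ≡ tallBefore i
      no-1+α = ∑-cong i (λ j j<i → ⟦1+a<⟧ α (inv ω j) (λ eq → <-irrefl (≡B eq) (<-trans j<i (<-trans i<A A<B))))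

    module FirstNonShort {m i} (i≤A : i ≤ A) (m≤i : m ≤ i) (short : ShortRun m i)
                         (ω⁻¹i≮α : ¬ inv ω i < α) where

      g : ℕ
      g = a + tallBefore m

      flat : tallBefore i ≡ tallBefore m
      flat = tallBefore-flat i m≤i short

      i≤1+g : i ≤ suc g
      i≤1+g = subst (λ t → i ≤ α + t) flat (≤-α+tallBefore i i≤A)

      below-diagonal : ∀ k → m ≤ k → k < i → towerOf ω k (g ∸ k) ≡ false
      below-diagonal k m≤k k<i = trans (towerOf-at ω (m+[n∸m]≡n k≤g)) (≥⇒<ᵇ≡false reach≤g)
        where
        k≤g : k ≤ g
        k≤g = s≤s⁻¹ (<-≤-trans k<i i≤1+g)
        reach≤g : reach ω k ≤ g
        reach≤g = s≤s⁻¹ (subst (λ t → suc (reach ω k) ≤ α + t)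
                    (tallBefore-flat k m≤k (λ j m≤j j<k → short j m≤j (<-trans j<k k<i)))
                    (reach-short k (<-≤-trans k<i i≤A) (short k m≤k k<i)))

      noDiag : i ≡ suc g → NoDiag (towerOf ω) (suc g) m
      noDiag i≡1+g k m≤k k≤g = below-diagonal k m≤k (subst (k <_) (sym i≡1+g) (s≤s k≤g))

      firstDiag : i ≤ g → g < reach ω i → FirstDiag (towerOf ω) (suc g) m i
      firstDiag i≤g g<reach =
        m≤i , i≤g , trans (towerOf-at ω (m+[n∸m]≡n i≤g)) (<⇒<ᵇ≡true g<reach) , below-diagonal

      reach≡1+g : i ≡ A → reach ω i ≡ suc g
      reach≡1+g i≡A = trans (cong (reach ω) i≡A) (trans reach-A (cong (α +_) (trans (cong tallBefore (sym i≡A)) flat)))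

      slide-at-A : i ≡ A → Slide (towerOf ω) (suc g) m (just (i , reach ω i ∸ i))
      slide-at-A i≡A with m≤n⇒m<n∨m≡n i≤1+g
      ... | inj₁ i≤g = subst (λ d → Slide (towerOf ω) (suc g) m (just (i , d ∸ i))) (sym (reach≡1+g i≡A))
          (s2a (firstDiag (s≤s⁻¹ i≤g) (subst (g <_) (sym (reach≡1+g i≡A)) ≤-refl))
               (trans (towerOf-at ω (m+[n∸m]≡n i≤1+g)) (≥⇒<ᵇ≡false (≤-reflexive (reach≡1+g i≡A)))))
      ... | inj₂ i≡1+g = subst (λ c → Slide (towerOf ω) (suc g) m (just c)) cell
          (s1a (noDiag i≡1+g) (trans (towerOf-at ω (+-identityʳ (suc g))) (≥⇒<ᵇ≡false (≤-reflexive reach≡))))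
        where
        reach≡ : reach ω (suc g) ≡ suc g
        reach≡ = trans (cong (reach ω) (sym i≡1+g)) (reach≡1+g i≡A)
        cell : (suc g , 0) ≡ (i , reach ω i ∸ i)
        cell = sym (cong₂ _,_ i≡1+g (trans (cong₂ _∸_ (reach≡1+g i≡A) i≡1+g) (n∸n≡0 (suc g))))

      module _ (i<A : i < A) where

        tall : suc (suc (suc g)) ≤ reach ω i
        tall = subst (λ t → 2 + α + t ≤ reach ω i) flat (reach-tall i i<A ω⁻¹i≮α)

        next-diagonal : α + tallBefore (suc i) ≡ suc (suc g)
        next-diagonal = begin
          α + (⟦ α < inv ω i ⟧ + tallBefore i) ≡⟨ cong₂ (λ x t → α + (x + t)) (⟦<⟧≡1 α<ω⁻¹i) flat ⟩
          α + suc (tallBefore m)               ≡⟨ cong suc (+-suc a (tallBefore m)) ⟩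
          suc (suc g)                          ∎
          where
          open ≡-Reasoning
          α<ω⁻¹i : α < inv ω i
          α<ω⁻¹i = ≤∧≢⇒< (≮⇒≥ ω⁻¹i≮α) (λ eq → <-irrefl (≡A (sym eq)) i<A)

        slide-past : Reaches (suc i) → Slide (towerOf ω) (suc g) m (just newCell)
        slide-past next with m≤n⇒m<n∨m≡n i≤1+g
        ... | inj₁ i≤g = s2c (firstDiag (s≤s⁻¹ i≤g) (≤-trans (n≤1+n _) (≤-trans (n≤1+n _) tall)))
                             (trans (towerOf-at ω (m+[n∸m]≡n i≤1+g)) (<⇒<ᵇ≡true (≤-trans (n≤1+n _) tall)))
                             (trans (towerOf-at ω (trans (+-suc i _) (cong suc (m+[n∸m]≡n i≤1+g)))) (<⇒<ᵇ≡true tall))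
                             (subst (λ γ → Slide (towerOf ω) γ (suc i) (just newCell)) next-diagonal next)
        ... | inj₂ i≡1+g = s1c (noDiag i≡1+g)
                               (trans (towerOf-at ω (+-identityʳ (suc g))) (<⇒<ᵇ≡true (≤-trans (n≤1+n _) tall′)))
                               (trans (towerOf-at ω (+-comm (suc g) 1)) (<⇒<ᵇ≡true tall′))
                               (subst₂ (λ γ m′ → Slide (towerOf ω) γ m′ (just newCell))
                                       next-diagonal (cong suc i≡1+g) next)
          where
          tall′ : suc (suc (suc g)) ≤ reach ω (suc g)
          tall′ = subst (λ z → suc (suc (suc g)) ≤ reach ω z) i≡1+g tall

    reaches : ∀ t {m i} → i + t ≡ A → m ≤ i → ShortRun m i → Reaches m
    reaches zero {m} {i} i+0≡A m≤i short =
      subst (λ c → Reaches′ c) (cong (λ z → z , reach ω z ∸ z) i≡A)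
            (FirstNonShort.slide-at-A (≤-reflexive i≡A) m≤i short ω⁻¹i≮α i≡A)
      where
      Reaches′ : ℕ × ℕ → Set
      Reaches′ c = Slide (towerOf ω) (α + tallBefore m) m (just c)
      i≡A : i ≡ A
      i≡A = trans (sym (+-identityʳ i)) i+0≡A
      ω⁻¹i≮α : ¬ inv ω i < α
      ω⁻¹i≮α = <-irrefl (trans (cong (inv ω) i≡A) inv-A)
    reaches (suc t) {m} {i} i+1+t≡A m≤i short with inv ω i <? α
    ... | yes ω⁻¹i<α = reaches t 1+i+t≡A (m≤n⇒m≤1+n m≤i) extended
      where
      1+i+t≡A : suc i + t ≡ A
      1+i+t≡A = trans (sym (+-suc i t)) i+1+t≡A
      extended : ShortRun m (suc i)
      extended j m≤j j<1+i with m≤n⇒m<n∨m≡n (s≤s⁻¹ j<1+i)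
      ... | inj₁ j<i  = short j m≤j j<i
      ... | inj₂ refl = ω⁻¹i<α
    ... | no ω⁻¹i≮α = FirstNonShort.slide-past (<⇒≤ i<A) m≤i short ω⁻¹i≮α i<A
                        (reaches t (trans (sym (+-suc i t)) i+1+t≡A) ≤-refl (λ j 1+i≤j j<1+i → ⊥-elim (<⇒≱ j<1+i 1+i≤j)))
      where
      i<A : i < A
      i<A = subst (i <_) i+1+t≡A (m<m+n i (s≤s z≤n))

    slide-newCell : SlideInto α (towerOf ω) newCell
    slide-newCell = subst (λ γ → Slide (towerOf ω) γ 1 (just newCell)) start
      (reaches (A ∸ 1) (m+[n∸m]≡n 1≤A) ≤-refl (λ j 1≤j j<1 → ⊥-elim (<⇒≱ j<1 1≤j)))
      where
      start : α + tallBefore 1 ≡ α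
      start = trans (cong (λ z → α + (⟦ α < z ⟧ + 0)) (inv-zero ω))
                    (trans (cong (λ z → α + (z + 0)) (⟦<⟧≡0 z≤n)) (+-identityʳ α))
      1≤A : 1 ≤ A
      1≤A = n≢0⇒n>0 (λ A≡0 → 1+n≢0 (trans (sym inv-A) (trans (cong (inv ω) A≡0) (inv-zero ω))))

-- Length and reduced words

data CellStep (N : ℕ) (ω : FinPerm) (a : ℕ) : Set where
  up   : fun ω (suc a) < fun ω (suc (suc a)) → cellCount N (ω ∙ suc a) ≡ suc (cellCount N ω) → CellStep N ω a
  down : cellCount N ω ≡ suc (cellCount N (ω ∙ suc a)) → CellStep N ω a

cellStep : ∀ {N ω} a → 3 + a ≤ N → Fixes N ω → CellStep N ω a
cellStep {N} {ω} a 3+a≤N F with <-cmp (fun ω (suc a)) (fun ω (suc (suc a)))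
... | tri< A<B _ _ = up A<B (Ascent.cellCount-∙ ω a A<B N (fun-< F (suc a) (<-trans (n<1+n _) 3+a≤N)))
... | tri≈ _ A≡B _ = ⊥-elim (<-irrefl (fun-injective ω A≡B) (n<1+n _))
... | tri> _ _ B<A = down (trans (cellCount-cong N {ω} {ω' ∙ suc a} ω≈ω's²) (Ascent.cellCount-∙ ω' a A'<B' N A'<N))
  where
  ω' = ω ∙ suc a
  ω≈ω's² : ω ≈ₚ ω' ∙ suc a
  ω≈ω's² = ≈ₚ-sym {ω' ∙ suc a} {ω} (∙-involutive ω (suc a))
  A'≡B : Ascent.A ω' a ≡ fun ω (suc (suc a))
  A'≡B = cong (fun ω) (s-left (suc a))
  A'<B' : Ascent.A ω' a < Ascent.B ω' a
  A'<B' = subst₂ _<_ (sym A'≡B) (cong (fun ω) (sym (s-right (suc a)))) B<A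
  A'<N : Ascent.A ω' a < N
  A'<N = subst (_< N) (sym A'≡B) (fun-< F (suc (suc a)) 3+a≤N)

≤-+⇒<-+-suc : ∀ {m n o x} → x ≡ suc n → m ≤ n + o → m < x + suc o
≤-+⇒<-+-suc {n = n} refl m≤n+o = s≤s (≤-trans m≤n+o (+-monoʳ-≤ n (n≤1+n _)))

cellCount-·-≤ : ∀ {N ω} w → LettersBelow N w → Fixes N ω → cellCount N (ω · w) ≤ cellCount N ω + length w
cellCount-·-≤ []            []                F = ≤-reflexive (sym (+-identityʳ _))
cellCount-·-≤ (zero ∷ w)    ((() , _) ∷ _)    F
cellCount-·-≤ {N} {ω} (suc a ∷ w) ((_ , 3+a≤N) ∷ ws) F
  with cellCount-·-≤ w ws (Fixes-∙ (suc a) 3+a≤N F) | cellStep a 3+a≤N F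
... | ih | up _ grows = ≤-trans ih (≤-reflexive (trans (cong (_+ length w) grows) (sym (+-suc _ _))))
... | ih | down shrinks = <⇒≤ (≤-+⇒<-+-suc shrinks ih)

-- When every letter adds a cell, every slide lands on the added cell.
tower-· : ∀ {N ω} w → LettersBelow N w → Fixes N ω → cellCount N (ω · w) ≡ cellCount N ω + length w →
          ∀ {T₀} → T₀ ≐ towerOf ω → Σ Cells λ T → TowerFrom T₀ w T × T ≐ towerOf (ω · w)
tower-· []            []                F _ T₀≐ = _ , done , T₀≐
tower-· (zero ∷ w)    ((() , _) ∷ _)    F
tower-· {N} {ω} (suc a ∷ w) ((_ , 3+a≤N) ∷ ws) F additive {T₀} T₀≐ with cellStep a 3+a≤N F
... | down shrinks =
  ⊥-elim (<-irrefl additive (≤-+⇒<-+-suc shrinks (cellCount-·-≤ w ws (Fixes-∙ (suc a) 3+a≤N F))))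
... | up A<B grows with tower-· w ws (Fixes-∙ (suc a) 3+a≤N F)
                          (trans additive (trans (+-suc _ _) (cong (_+ length w) (sym grows))))
                          (≐-trans (insert-cong _ T₀≐) (≐-sym (Ascent.towerOf-∙ ω a A<B)))
... | T , tf , T≐ = T , step (Slide-resp-≐ (≐-sym T₀≐) (SlideAscent.slide-newCell ω a A<B)) tf , T≐

Ascending : ℕ → FinPerm → Set
Ascending N ω = ∀ α → 1 ≤ α → suc α < N → fun ω α < fun ω (suc α)

ascending⇒id : ∀ {N ω} → Fixes N ω → Ascending N ω → ω ≈ₚ idₚ
ascending⇒id {N} {ω} F ascending x with x <? N
... | no x≮N  = fixes F x (≮⇒≥ x≮N)
... | yes x<N = ≤-antisym (≤-self (N ∸ suc x) x (m+[n∸m]≡n x<N)) (self-≤ x x<N)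
  where
  self-≤ : ∀ x → x < N → x ≤ fun ω x
  self-≤ zero          _      = z≤n
  self-≤ (suc zero)    _      = n≢0⇒n>0 (λ ω1≡0 → 1+n≢0 (fun-injective ω (trans ω1≡0 (sym (fix-zero ω)))))
  self-≤ (suc (suc x)) 2+x<N  =
    ≤-trans (s≤s (self-≤ (suc x) (<-trans (n<1+n _) 2+x<N))) (ascending (suc x) (s≤s z≤n) 2+x<N)
  ≤-self : ∀ d x → suc (x + d) ≡ N → fun ω x ≤ x
  ≤-self zero     x       1+x+0≡N = s≤s⁻¹ (subst (fun ω x <_) (sym 1+x≡N) (fun-< F x (≤-reflexive 1+x≡N)))
    where
    1+x≡N : suc x ≡ N
    1+x≡N = trans (cong suc (sym (+-identityʳ x))) 1+x+0≡N
  ≤-self (suc d)  zero    _       = ≤-reflexive (fix-zero ω)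
  ≤-self (suc d)  (suc x) eq      =
    s≤s⁻¹ (<-≤-trans (ascending (suc x) (s≤s z≤n) 2+x<N) (≤-self d (suc (suc x)) eq′))
    where
    eq′ : suc (suc (suc x) + d) ≡ N
    eq′ = trans (cong suc (sym (+-suc (suc x) d))) eq
    2+x<N : suc (suc x) < N
    2+x<N = subst (suc (suc x) <_) eq′ (s≤s (m≤m+n _ d))

∙-cong : ∀ {ω ω'} a → ω ≈ₚ ω' → ω ∙ a ≈ₚ ω' ∙ a
∙-cong zero    ω≈ω' = ω≈ω'
∙-cong (suc a) ω≈ω' x = ω≈ω' (s (suc a) x)

word-of-length-cellCount : ∀ n {N ω} → Fixes N ω → cellCount N ω ≡ n →
                           Σ (List ℕ) λ w → LettersBelow N w × idₚ · w ≈ₚ ω × length w ≡ n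
word-of-length-cellCount n {N} {ω} F count≡n with anyUpTo? descent? N
  where
  descent? : ∀ α → Dec (1 ≤ α × suc α < N × fun ω (suc α) < fun ω α)
  descent? α = 1 ≤? α ×-dec suc α <? N ×-dec fun ω (suc α) <? fun ω α
... | no no-descent with ascending⇒id F ascending
  where
  ascending : Ascending N ω
  ascending α 1≤α 1+α<N =
    ≤∧≢⇒< (≮⇒≥ (λ desc → no-descent (α , <-trans (n<1+n α) 1+α<N , 1≤α , 1+α<N , desc)))
          (λ eq → 1+n≢n (sym (fun-injective ω eq)))
... | ω≈id with n
...   | zero  = [] , [] , ≈ₚ-sym {ω} {idₚ} ω≈id , refl
...   | suc _ = ⊥-elim (1+n≢0 (trans (sym count≡n) (trans (cellCount-cong N {ω} {idₚ} ω≈id) (cellCount-idₚ N))))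
word-of-length-cellCount n {N} {ω} F count≡n | yes (zero , _ , () , _)
word-of-length-cellCount n {N} {ω} F count≡n | yes (suc a , _ , 1≤α , 3+a≤N , desc) with cellStep a 3+a≤N F
... | up A<B _ = ⊥-elim (<-asym desc A<B)
... | down shrinks with n
...   | zero = ⊥-elim (1+n≢0 (trans (sym shrinks) count≡n))
...   | suc n′ with word-of-length-cellCount n′ (Fixes-∙ (suc a) 3+a≤N F) (suc-injective (trans (sym shrinks) count≡n))
...     | w , ws , idₚ·w≈ , length≡ = w ∷ʳ suc a , ∷ʳ⁺ ws (1≤α , 3+a≤N) , represents , length-∷ʳ
  where
  represents : idₚ · (w ∷ʳ suc a) ≈ₚ ω
  represents rewrite ·-++ idₚ w [ suc a ] =
    ≈ₚ-trans {idₚ · w ∙ suc a} {ω ∙ suc a ∙ suc a} {ω}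
             (∙-cong {idₚ · w} {ω ∙ suc a} (suc a) idₚ·w≈) (∙-involutive ω (suc a))
  length-∷ʳ : length (w ∷ʳ suc a) ≡ suc n′
  length-∷ʳ = trans (length-++ w) (trans (+-comm (length w) 1) (cong suc length≡))

-- The code diagram determines the permutation

reach-≤ : ∀ {ω ω'} → towerOf ω ≐ towerOf ω' → ∀ i → reach ω i ≤ reach ω' i
reach-≤ {ω} {ω'} T≐T' i =
  ≮⇒≥ λ reach'<reach → not-¬ (in-T reach'<reach) (trans (T≐T' i _) not-in-T')
  where
  top' : i + (reach ω' i ∸ i) ≡ reach ω' i
  top' = m+[n∸m]≡n (≤-reach ω' i)
  in-T : reach ω' i < reach ω i → towerOf ω i (reach ω' i ∸ i) ≡ true
  in-T reach'<reach = trans (towerOf-at ω top') (<⇒<ᵇ≡true reach'<reach)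
  not-in-T' : towerOf ω' i (reach ω' i ∸ i) ≡ false
  not-in-T' = trans (towerOf-at ω' top') (≥⇒<ᵇ≡false {reach ω' i} ≤-refl)

inv-not-below : ∀ ω ω' j → (∀ k → k < j → inv ω k ≡ inv ω' k) → reach ω j ≡ reach ω' j →
                ¬ inv ω j < inv ω' j
inv-not-below ω ω' j agree reach≡ ω⁻¹j<ω'⁻¹j =
  <-irrefl reach≡ (subst (reach ω j <_) same (+-countAbove-< (inv-injective ω) j ω⁻¹j<ω'⁻¹j fresh))
  where
  fresh : ∀ k → k < j → inv ω k ≢ inv ω' j
  fresh k k<j eq = <-irrefl (inv-injective ω' (trans (sym (agree k k<j)) eq)) k<j
  same : inv ω' j + countAbove (inv ω) j (inv ω' j) ≡ reach ω' j
  same = cong (inv ω' j +_) (∑-cong j (λ k k<j → cong ⟦ inv ω' j <_⟧ (agree k k<j)))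

-- ω⁻¹ j is read off from reach ω j once ω⁻¹ is known below j.
inv-agree-below : ∀ ω ω' n → (∀ i → i < n → reach ω i ≡ reach ω' i) → ∀ j → j < n → inv ω j ≡ inv ω' j
inv-agree-below ω ω' n reach≡ = <-rec (λ j → j < n → inv ω j ≡ inv ω' j) by-trichotomy
  where
  by-trichotomy : ∀ j → (∀ {k} → k < j → k < n → inv ω k ≡ inv ω' k) → j < n → inv ω j ≡ inv ω' j
  by-trichotomy j ih j<n with <-cmp (inv ω j) (inv ω' j)
  ... | tri≈ _ eq _ = eq
  ... | tri< lt _ _ = ⊥-elim (inv-not-below ω ω' j agree (reach≡ j j<n) lt)
    where
    agree : ∀ k → k < j → inv ω k ≡ inv ω' k
    agree k k<j = ih k<j (<-trans k<j j<n)
  ... | tri> _ _ gt = ⊥-elim (inv-not-below ω' ω j agree (sym (reach≡ j j<n)) gt)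
    where
    agree : ∀ k → k < j → inv ω' k ≡ inv ω k
    agree k k<j = sym (ih k<j (<-trans k<j j<n))

inv≗⇒≈ₚ : ∀ {ω ω'} → (∀ x → inv ω x ≡ inv ω' x) → ω ≈ₚ ω'
inv≗⇒≈ₚ {ω} {ω'} inv≗ x =
  trans (sym (fun-inv ω' (fun ω x))) (cong (fun ω') (trans (sym (inv≗ (fun ω x))) (inv-fun ω x)))

towerOf-injective : ∀ {ω ω'} → towerOf ω ≐ towerOf ω' → ω ≈ₚ ω'
towerOf-injective {ω} {ω'} T≐T' =
  inv≗⇒≈ₚ {ω} {ω'} (λ x → inv-agree-below ω ω' (suc x) (λ i _ → reach≡ i) x ≤-refl)
  where
  reach≡ : ∀ i → reach ω i ≡ reach ω' i
  reach≡ i = ≤-antisym (reach-≤ {ω} {ω'} T≐T' i) (reach-≤ {ω'} {ω} (≐-sym T≐T') i)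

-- Every tower diagram is a code diagram

least-nonzero : ∀ (h : ℕ → ℕ) n →
                (Σ ℕ λ a → a < n × 0 < h a × (∀ j → j < a → h j ≡ 0)) ⊎ (∀ j → j < n → h j ≡ 0)
least-nonzero h zero = inj₂ (λ _ ())
least-nonzero h (suc n) with least-nonzero h n
... | inj₁ (a , a<n , ha>0 , zero-below) = inj₁ (a , m<n⇒m<1+n a<n , ha>0 , zero-below)
... | inj₂ zero-below with h n ≟ 0
...   | no hn≢0 = inj₁ (n , ≤-refl , n≢0⇒n>0 hn≢0 , zero-below)
...   | yes hn≡0 = inj₂ zero-below′
  where
  zero-below′ : ∀ j → j < suc n → h j ≡ 0
  zero-below′ j j<1+n with m≤n⇒m<n∨m≡n (s≤s⁻¹ j<1+n)
  ... | inj₁ j<n  = zero-below j j<n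
  ... | inj₂ refl = hn≡0

decrementAt : ℕ → (ℕ → ℕ) → ℕ → ℕ
decrementAt a h i with i ≟ a
... | yes _ = pred (h i)
... | no _  = h i

decrementAt-other : ∀ a h i → i ≢ a → decrementAt a h i ≡ h i
decrementAt-other a h i i≢a with i ≟ a
... | yes i≡a = ⊥-elim (i≢a i≡a)
... | no _    = refl

decrementAt-at : ∀ a h → 0 < h a → suc (decrementAt a h a) ≡ h a
decrementAt-at a h ha>0 with a ≟ a
... | no a≢a = ⊥-elim (a≢a refl)
... | yes _  = suc-pred (h a) {{>-nonZero ha>0}}

-- The first nonempty column a of 𝒯_ω is raised by ω ↦ ω s_α where α = ω⁻¹ a.
ascent-into-first-column : ∀ ω a → 1 ≤ a → (∀ j → j < a → reach ω j ≡ j) →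
                           Σ ℕ λ a₀ → Ascent.A ω a₀ ≡ a × Ascent.A ω a₀ < Ascent.B ω a₀
ascent-into-first-column ω a 1≤a empty-below = pred v , A≡a , A<B
  where
  inv-id : ∀ j → j < a → inv ω j ≡ j
  inv-id = inv-agree-below ω idₚ a (λ j j<a → trans (empty-below j j<a) (sym (reach-idₚ j)))
  v : ℕ
  v = inv ω a
  a≤v : a ≤ v
  a≤v = ≮⇒≥ (λ v<a → <-irrefl (inv-injective ω (inv-id v v<a)) v<a)
  1+pred-v : suc (pred v) ≡ v
  1+pred-v = suc-pred v {{>-nonZero (≤-trans 1≤a a≤v)}}
  open Ascent ω (pred v) using (A; B; inv-B)
  A≡a : A ≡ a
  A≡a = trans (cong (fun ω) 1+pred-v) (fun-inv ω a)
  A<B : A < B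
  A<B with <-cmp a B
  ... | tri< a<B _ _ = subst (_< B) (sym A≡a) a<B
  ... | tri≈ _ a≡B _ = ⊥-elim (1+n≢n (trans (sym inv-B) (trans (cong (inv ω) (sym a≡B)) (sym 1+pred-v))))
  ... | tri> _ _ B<a = ⊥-elim (<-irrefl B≡1+v (<-trans B<a (s≤s a≤v)))
    where
    B≡1+v : B ≡ suc v
    B≡1+v = trans (sym (inv-id B B<a)) (trans inv-B (cong suc 1+pred-v))

raise-first-column : ∀ {ω₀ h a} → 1 ≤ a → 0 < h a → (∀ j → j < a → h j ≡ 0) →
                     (∀ i → reach ω₀ i ≡ i + decrementAt a h i) → Σ FinPerm λ ω → ∀ i → reach ω i ≡ i + h i
raise-first-column {ω₀} {h} {a} 1≤a ha>0 zero-below reach≡ with ascent-into-first-column ω₀ a 1≤a empty-below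
  where
  empty-below : ∀ j → j < a → reach ω₀ j ≡ j
  empty-below j j<a = begin
    reach ω₀ j              ≡⟨ reach≡ j ⟩
    j + decrementAt a h j   ≡⟨ cong (j +_) (decrementAt-other a h j (λ j≡a → <-irrefl j≡a j<a)) ⟩
    j + h j                 ≡⟨ cong (j +_) (zero-below j j<a) ⟩
    j + 0                   ≡⟨ +-identityʳ j ⟩
    j                       ∎
    where open ≡-Reasoning
... | a₀ , A≡a , A<B = ω₀ ∙ suc a₀ , raised
  where
  open Ascent ω₀ a₀ using (A; reach-∙-≢A; reach-∙-A)
  raised : ∀ i → reach (ω₀ ∙ suc a₀) i ≡ i + h i
  raised i with i ≟ A
  ... | no i≢A = trans (reach-∙-≢A A<B i i≢A)
                       (trans (reach≡ i) (cong (i +_) (decrementAt-other a h i (λ i≡a → i≢A (trans i≡a (sym A≡a))))))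
  ... | yes refl = begin
    reach (ω₀ ∙ suc a₀) A          ≡⟨ reach-∙-A A<B ⟩
    suc (reach ω₀ A)               ≡⟨ cong suc (reach≡ A) ⟩
    suc (A + decrementAt a h A)    ≡⟨ +-suc A _ ⟨
    A + suc (decrementAt a h A)    ≡⟨ cong (λ z → A + suc (decrementAt a h z)) A≡a ⟩
    A + suc (decrementAt a h a)    ≡⟨ cong (A +_) (decrementAt-at a h ha>0) ⟩
    A + h a                        ≡⟨ cong (λ z → A + h z) A≡a ⟨
    A + h A                        ∎
    where open ≡-Reasoning

realise-heights : ∀ S {bound} h → h 0 ≡ 0 → (∀ i → bound ≤ i → h i ≡ 0) → ∑< bound h ≡ S →
                  Σ FinPerm λ ω → ∀ i → reach ω i ≡ i + h i
realise-heights zero {bound} h _ h-bounded ∑≡0 =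
  idₚ , λ i → trans (reach-idₚ i) (sym (trans (cong (i +_) (h≡0 i)) (+-identityʳ i)))
  where
  h≡0 : ∀ i → h i ≡ 0
  h≡0 i with i <? bound
  ... | yes i<bound = ∑≡0⇒zero bound ∑≡0 i i<bound
  ... | no i≮bound  = h-bounded i (≮⇒≥ i≮bound)
realise-heights (suc S) {bound} h h0≡0 h-bounded ∑≡1+S with least-nonzero h bound
... | inj₂ zero-below = ⊥-elim (1+n≢0 (trans (sym ∑≡1+S) (∑-zero bound zero-below)))
... | inj₁ (a , a<bound , ha>0 , zero-below) =
  let ω₀ , reach≡ = realise-heights S (decrementAt a h) h′0≡0 h′-bounded ∑h′≡S
  in raise-first-column {ω₀} (n≢0⇒n>0 a≢0) ha>0 zero-below reach≡
  where
  a≢0 : a ≢ 0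
  a≢0 a≡0 = <-irrefl (sym (trans (cong h a≡0) h0≡0)) ha>0
  h′0≡0 : decrementAt a h 0 ≡ 0
  h′0≡0 = trans (decrementAt-other a h 0 (a≢0 ∘ sym)) h0≡0
  h′-bounded : ∀ i → bound ≤ i → decrementAt a h i ≡ 0
  h′-bounded i bound≤i =
    trans (decrementAt-other a h i (λ i≡a → <-irrefl (sym i≡a) (<-≤-trans a<bound bound≤i))) (h-bounded i bound≤i)
  ∑h′≡S : ∑< bound (decrementAt a h) ≡ S
  ∑h′≡S = suc-injective (trans (sym (∑-bump bound a a<bound (λ j _ j≢a → sym (decrementAt-other a h j j≢a))
                                                 (sym (decrementAt-at a h ha>0)))) ∑≡1+S)

module ColumnHeights {T : Cells} (td : IsTowerDiagram T) where
  open IsTowerDiagram td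

  bound : ℕ
  bound = proj₁ finite

  cell : ℕ → ℕ → ℕ
  cell i k = if T i k then 1 else 0

  cell≡1 : ∀ {i k} → T i k ≡ true → cell i k ≡ 1
  cell≡1 ik∈ = cong (λ b → if b then 1 else 0) ik∈

  height : ℕ → ℕ
  height i = ∑[ k < bound ] cell i k

  height-zero : height 0 ≡ 0
  height-zero = ∑-zero bound (λ k _ → cong (λ b → if b then 1 else 0) (no-col-zero k))

  height-bounded : ∀ i → bound ≤ i → height i ≡ 0
  height-bounded i bound≤i = ∑-zero bound empty
    where
    empty : ∀ k → k < bound → cell i k ≡ 0
    empty k _ with T i k in ik∈
    ... | false = refl
    ... | true  = ⊥-elim (<-irrefl refl (<-≤-trans (proj₁ (proj₂ finite i k ik∈)) bound≤i))

  <-height : ∀ i k → T i k ≡ true → k < height i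
  <-height i k ik∈ = begin
    suc k                     ≡⟨ ∑-1 (suc k) ⟨
    ∑[ k' < suc k ] 1         ≡⟨ ∑-cong (suc k) (λ k' k'≤k → sym (cell≡1 (down-closed i k k' ik∈ (s≤s⁻¹ k'≤k)))) ⟩
    ∑[ k' < suc k ] cell i k' ≤⟨ ∑-prefix-≤ (bound ∸ suc k) (suc k) ⟩
    ∑[ k' < bound ∸ suc k + suc k ] cell i k' ≡⟨ cong (λ n → ∑[ k' < n ] cell i k') (m∸n+n≡m k<bound) ⟩
    height i                  ∎
    where
    open ≤-Reasoning
    k<bound : k < bound
    k<bound = proj₂ (proj₂ finite i k ik∈)
    ∑-prefix-≤ : ∀ t n → ∑[ k' < n ] cell i k' ≤ ∑[ k' < t + n ] cell i k'
    ∑-prefix-≤ zero    n = ≤-refl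
    ∑-prefix-≤ (suc t) n = ≤-trans (∑-prefix-≤ t n) (m≤n+m _ _)

  height-≤ : ∀ i k → T i k ≡ false → height i ≤ k
  height-≤ i k ik∉ = ≤-trans (∑-mono-≤ bound below-k) (count-∈-≤ (λ eq → eq) bound 0 k)
    where
    below-k : ∀ k' → k' < bound → cell i k' ≤ ⟦ k' ∈[ 0 , k ⟩⟧
    below-k k' _ with k' <? k | T i k' in ik'∈
    ... | _        | false = z≤n
    ... | yes k'<k | true  rewrite ⟦∈⟧≡1 z≤n k'<k = ≤-refl
    ... | no k'≮k  | true  = ⊥-elim (not-¬ (down-closed i k' k ik'∈ (≮⇒≥ k'≮k)) ik∉)

  T≡<ᵇ : ∀ i k → T i k ≡ ((i + k) <ᵇ (i + height i))
  T≡<ᵇ i k with T i k in ik∈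
  ... | true  = sym (<⇒<ᵇ≡true (+-monoʳ-< i (<-height i k ik∈)))
  ... | false = sym (≥⇒<ᵇ≡false (+-monoʳ-≤ i (height-≤ i k ik∈)))

towerOf-surjective : ∀ {T} → IsTowerDiagram T → Σ FinPerm λ ω → towerOf ω ≐ T
towerOf-surjective {T} td with realise-heights _ height height-zero height-bounded refl
  where open ColumnHeights td
... | ω , reach≡ = ω , λ i k → trans (cong ((i + k) <ᵇ_) (reach≡ i)) (sym (ColumnHeights.T≡<ᵇ td i k))

-- Tower diagrams of reduced words

maxLetter : List ℕ → ℕ
maxLetter []      = 0
maxLetter (a ∷ w) = a ⊔ maxLetter w

LettersBelow-maxLetter : ∀ {N} w → All (1 ≤_) w → 2 + maxLetter w ≤ N → LettersBelow N w
LettersBelow-maxLetter []      []       _ = []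
LettersBelow-maxLetter (a ∷ w) (1≤a ∷ positive) 2+max≤N =
  (1≤a , ≤-trans (s≤s (s≤s (m≤m⊔n a (maxLetter w)))) 2+max≤N)
  ∷ LettersBelow-maxLetter w positive (≤-trans (s≤s (s≤s (m≤n⊔m a (maxLetter w)))) 2+max≤N)

Represents⇒≈ₚ : ∀ {w} ω → Represents w ω → idₚ · w ≈ₚ ω
Represents⇒≈ₚ {w} ω (positive , eval≡) x = trans (fun-· idₚ w positive x) (eval≡ x)

LettersBelow⇒Represents : ∀ {N w} ω → LettersBelow N w → idₚ · w ≈ₚ ω → Represents w ω
LettersBelow⇒Represents {w = w} ω ws idₚ·w≈ω =
  All.map proj₁ ws , λ x → trans (sym (fun-· idₚ w (All.map proj₁ ws) x)) (idₚ·w≈ω x)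

cellCount-≤-length : ∀ {N ω w} → Fixes N ω → Represents w ω → cellCount N ω ≤ length w
cellCount-≤-length {N} {ω} {w} F rep = begin
  cellCount N ω                       ≡⟨ cellCount-stable K F ⟨
  cellCount (K + N) ω                 ≡⟨ cellCount-cong (K + N) {ω} {idₚ · w} (≈ₚ-sym {idₚ · w} {ω} (Represents⇒≈ₚ ω rep)) ⟩
  cellCount (K + N) (idₚ · w)         ≤⟨ cellCount-·-≤ w ws (Fixes-idₚ _) ⟩
  cellCount (K + N) idₚ + length w    ≡⟨ cong (_+ length w) (cellCount-idₚ (K + N)) ⟩
  length w                            ∎
  where
  open ≤-Reasoning
  K = 2 + maxLetter w
  ws : LettersBelow (K + N) w
  ws = LettersBelow-maxLetter w (proj₁ rep) (m≤m+n K N)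

reducedWord : ∀ ω → Σ (List ℕ) λ w → IsReducedWord w ω
reducedWord ω with word-of-length-cellCount _ (Fixes-support ω) refl
... | w , ws , idₚ·w≈ω , length≡ =
  w , LettersBelow⇒Represents ω ws idₚ·w≈ω ,
  λ w' rep' → ≤-trans (≤-reflexive length≡) (cellCount-≤-length (Fixes-support ω) rep')

-- A reduced word adds a cell with every letter, so it slides into 𝒯_ω.
reduced-tower : ∀ {w} ω → IsReducedWord w ω → Σ Cells λ T → WordTower w T × T ≐ towerOf ω
reduced-tower {w} ω (rep , minimal) with tower-· w ws (Fixes-idₚ N) additive (≐-sym towerOf-idₚ)
  where
  N = (2 + maxLetter w) + proj₁ (support ω)
  ws : LettersBelow N w
  ws = LettersBelow-maxLetter w (proj₁ rep) (m≤m+n _ _)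
  F : Fixes N ω
  F = Fixes-mono (m≤n+m _ _) (Fixes-support ω)
  length≤ : length w ≤ cellCount N ω
  length≤ = let w₀ , ws₀ , idₚ·w₀≈ω , length≡ = word-of-length-cellCount _ F refl
            in ≤-trans (minimal w₀ (LettersBelow⇒Represents ω ws₀ idₚ·w₀≈ω)) (≤-reflexive length≡)
  additive : cellCount N (idₚ · w) ≡ cellCount N idₚ + length w
  additive = begin
    cellCount N (idₚ · w)      ≡⟨ cellCount-cong N {idₚ · w} {ω} (Represents⇒≈ₚ ω rep) ⟩
    cellCount N ω              ≡⟨ ≤-antisym (cellCount-≤-length F rep) length≤ ⟩
    length w                   ≡⟨ cong (_+ length w) (cellCount-idₚ N) ⟨
    cellCount N idₚ + length w ∎
    where open ≡-Reasoning
... | T , wt , T≐ = T , wt , ≐-trans T≐ (towerOf-cong {idₚ · w} {ω} (Represents⇒≈ₚ ω rep))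

WordTower-reduced : ∀ {w T} ω → IsReducedWord w ω → WordTower w T → T ≐ towerOf ω
WordTower-reduced ω red wt with reduced-tower ω red
... | T' , wt' , T'≐ = ≐-trans (TowerFrom-functional (λ _ _ → refl) wt wt') T'≐

reducedWord-tower : ∀ ω → Σ (List ℕ) λ w → Σ Cells λ T → IsReducedWord w ω × WordTower w T × T ≐ towerOf ω
reducedWord-tower ω =
  let w , red      = reducedWord ω
      T , wt , T≐ = reduced-tower ω red
  in w , T , red , wt , T≐

corollary4p5 :
    -- the map is total and lands in tower diagrams
    ((ω : FinPerm) → Σ (List ℕ) λ w → Σ Cells λ T →
      IsReducedWord w ω × WordTower w T × IsTowerDiagram T)
    ×
    -- injectivity: reduced words with equal tower diagrams represent equal permutations
    ((ω ω' : FinPerm) (w w' : List ℕ) (T T' : Cells) →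
      IsReducedWord w ω → IsReducedWord w' ω' →
      WordTower w T → WordTower w' T' → T ≐ T' → ω ≈ₚ ω')
    ×
    -- surjectivity: every tower diagram is the tower diagram of a reduced word of some ω
    ((T : Cells) → IsTowerDiagram T →
      Σ FinPerm λ ω → Σ (List ℕ) λ w → Σ Cells λ T' →
        IsReducedWord w ω × WordTower w T' × T' ≐ T)
corollary4p5 =
    (λ ω → let w , T , red , wt , T≐ = reducedWord-tower ω
           in w , T , red , wt , IsTowerDiagram-resp-≐ (≐-sym T≐) (towerOf-isTowerDiagram ω))
  , (λ ω ω' w w' T T' red red' wt wt' T≐T' → towerOf-injective {ω} {ω'}
       (≐-trans (≐-sym (WordTower-reduced ω red wt)) (≐-trans T≐T' (WordTower-reduced ω' red' wt'))))
  , (λ T td → let ω , towerOf≐T = towerOf-surjective td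
                  w , T' , red , wt , T'≐ = reducedWord-tower ω
              in ω , w , T' , red , wt , ≐-trans T'≐ towerOf≐T)
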